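{- Let $\mathbf{B}$ be a connected bidirected graph with $n\ge1$ arrows and let $x\in\mathbb{Z}^n$. If $I(\mathbf{B})^Tx=e_s+\tau e_t$ for vertices $s,t\in V(\mathbf{B})$ and a sign $\tau\in\{\pm1\}$, then there is a walk $\omega$ from $s$ to $t$ such that $x=\mathrm{inc}(\omega)$.
   Context: A bidirected graph $\mathbf{B}$: vertices $V(\mathbf{B})$, arrows $E(\mathbf{B})=\{1,\dots,n\}$, each arrow $i$ with a multiset $\mathbbm{v}(i)=\{(u,\epsilon),(u',\epsilon')\}\subset V(\mathbf{B})\times\{\pm1\}$; directed if $\epsilon\ne\epsilon'$, bidirected if $\epsilon=\epsilon'$, a loop if $u=u'$; sign $\sigma(i)=-\epsilon\epsilon'$. Incidence matrix $I(\mathbf{B})$: $I(\mathbf{B})^Te_i=\epsilon e_u+\epsilon'e_{u'}$, with $e_u$ the canonical vectors of $\mathbb{Z}^{V(\mathbf{B})}$. Connected: underlying multigraph connected. Add formal inverses $i^{ -1}$ of directed loops (same endpoints and sign). A walk $\omega=(v_0,i_1,v_1,\dots,i_\ell,v_\ell)$ (from $v_0$ to $v_\ell$) has each $i_t$ an arrow or formal inverse with endpoint set $\{v_{t-1},v_t\}$; $\sigma(\omega)=\prod\sigma(i_t)$. Let $d(v,i)=d$ if $(v,d)\in\mathbbm{v}(i)$ and $(v,-d)\notin\mathbbm{v}(i)$; $d(v,i)=1$ for a directed loop $i$ at $v$; $d(v,i^{ -1})=-1$ for its formal inverse; $0$ otherwise. Then $\mathrm{inc}(\omega)=\sum_{t=1}^\ell\sigma(\omega^{[t-1]})d(v_{t-1},i_t)e_{i_t}$,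 with $\omega^{[t]}$ the initial subwalk of length $t$ and $e_{i^{ -1}}:=e_i$. -}

module Defs where

open import Data.Nat using (ℕ; zero; suc)
open import Data.Fin using (Fin; zero; suc) renaming (_≟_ to _≟ᶠ_)
open import Data.Integer using (ℤ; +_; -_; _+_; _*_; 0ℤ; 1ℤ; -1ℤ)
open import Data.Sign.Base using (Sign; opposite) renaming (_*_ to _*ˢ_; + to pos; - to neg)
open import Data.Sign.Properties using () renaming (_≟_ to _≟ˢ_)
open import Data.Product using (Σ; _×_; _,_)
open import Data.Sum using (_⊎_)
open import Data.Bool using (Bool; true; false; if_then_else_; _∧_; _∨_; not)
open import Relation.Nullary using (¬_)
open import Relation.Nullary.Decidable using (⌊_⌋)
open import Relation.Binary.PropositionalEquality using (_≡_)
open import Relation.Binary.Construct.Closure.ReflexiveTransitive using (Star)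

⟦_⟧ : Sign → ℤ
⟦ pos ⟧ = 1ℤ
⟦ neg ⟧ = -1ℤ

sumFin : (n : ℕ) → (Fin n → ℤ) → ℤ
sumFin zero    f = 0ℤ
sumFin (suc n) f = f zero + sumFin n (λ j → f (suc j))

δ : ∀ {k} → Fin k → Fin k → ℤ
δ a b = if ⌊ a ≟ᶠ b ⌋ then 1ℤ else 0ℤ

-- Arrow i has endpoint multiset {(tail₁ i , sg₁ i) , (tail₂ i , sg₂ i)}
-- (the order of the two half-arrows is an arbitrary presentation).
record Bidirected (n : ℕ) : Set where
  field
    nV  : ℕ
    end₁ : Fin n → Fin nV
    sg₁  : Fin n → Sign
    end₂ : Fin n → Fin nV
    sg₂  : Fin n → Sign

module _ {n : ℕ} (B : Bidirected n) where
  open Bidirected B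

  V : Set
  V = Fin nV

  σ : Fin n → Sign
  σ i = opposite (sg₁ i *ˢ sg₂ i)

  EndsAre : Fin n → V → V → Set
  EndsAre i a b = (end₁ i ≡ a × end₂ i ≡ b) ⊎ (end₁ i ≡ b × end₂ i ≡ a)

  DirectedLoop : Fin n → Set
  DirectedLoop i = (end₁ i ≡ end₂ i) × ¬ (sg₁ i ≡ sg₂ i)

  -- I(B)^T x : the vertex vector with I(B)^T e_i = ε e_u + ε' e_u'
  incT : (Fin n → ℤ) → V → ℤ
  incT x v = sumFin n (λ i → x i * (⟦ sg₁ i ⟧ * δ (end₁ i) v + ⟦ sg₂ i ⟧ * δ (end₂ i) v))

  Adjacent : V → V → Set
  Adjacent a b = Σ (Fin n) (λ i → EndsAre i a b)

  Connected : Set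
  Connected = (a b : V) → Star Adjacent a b

  -- steps of a walk: an arrow, or the formal inverse of a directed loop
  data Step : Set where
    arr : Fin n → Step
    inv : (i : Fin n) → DirectedLoop i → Step

  stepArrow : Step → Fin n
  stepArrow (arr i)   = i
  stepArrow (inv i _) = i

  -- formal inverses have the same endpoints and sign as the loop
  stepσ : Step → Sign
  stepσ s = σ (stepArrow s)

  memb : V → Sign → Fin n → Bool
  memb v d i = (⌊ end₁ i ≟ᶠ v ⌋ ∧ ⌊ sg₁ i ≟ˢ d ⌋) ∨ (⌊ end₂ i ≟ᶠ v ⌋ ∧ ⌊ sg₂ i ≟ˢ d ⌋)

  isDirLoopAt : V → Fin n → Bool
  isDirLoopAt v i = ⌊ end₁ i ≟ᶠ v ⌋ ∧ ⌊ end₂ i ≟ᶠ v ⌋ ∧ not ⌊ sg₁ i ≟ˢ sg₂ i ⌋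

  dir : V → Step → ℤ
  dir v (arr i) =
    if memb v pos i ∧ not (memb v neg i) then 1ℤ
    else if memb v neg i ∧ not (memb v pos i) then -1ℤ
    else if isDirLoopAt v i then 1ℤ
    else 0ℤ
  dir v (inv i _) = if isDirLoopAt v i then -1ℤ else 0ℤ

  data Walk : V → V → Set where
    [] : ∀ {a} → Walk a a
    step : ∀ {a b c} (s : Step) → EndsAre (stepArrow s) a b → Walk b c → Walk a c

  -- inc with running sign accumulator: σ(ω^{[t-1]}) d(v_{t-1}, i_t) e_{i_t}
  incAcc : ∀ {a b} → Sign → Walk a b → Fin n → ℤ
  incAcc sg []                   j = 0ℤ
  incAcc {a} sg (step s _ w)     j =
    ⟦ sg ⟧ * dir a s * δ (stepArrow s) j + incAcc (sg *ˢ stepσ s) w j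

  inc : ∀ {a b} → Walk a b → Fin n → ℤ
  inc = incAcc pos

-- Induction on ‖x‖₁, proving more: the walk can be chosen with sign σ(ω) = −τ.  Unless s = t and
-- τ = −, the entry of I(B)ᵀx at s is positive, so some arrow i at s has x_i (I(B)ᵀe_i)_s > 0.  Walk
-- from s along i to its other end b, with d = d(s, i) = ±1 of the same sign as x_i: the remainder
-- x′ = σ(i)(x − d e_i) has I(B)ᵀx′ = e_b + σ(i)τ e_t and ‖x′‖₁ = ‖x‖₁ − 1, and prepending the step
-- to a walk for x′ realises x.  If s = t and τ = −, then I(B)ᵀx = 0 and for x ≠ 0 such a step still
-- exists at an end u of an arrow in the support of x (for a directed loop, the loop or its formal
-- inverse), giving closed walks of sign + at u realising ±x.  They are moved to s along a path by
-- detours a →ᵢ ω →ᵢ a, whose two contributions on i cancel because d(a, i) + σ(i) d(b, i) = 0; a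
-- detour multiplies inc by σ(i), which is why closed walks for both x and −x are carried along.

module Submission where

open import Defs
open import Data.Nat as ℕ using (ℕ; zero; suc; s≤s; z≤n)
import Data.Nat.Properties as ℕP
open import Data.Fin using (Fin; zero; suc) renaming (_≟_ to _≟ᶠ_)
open import Data.Fin.Properties using (any?; suc-injective)
open import Data.Integer using (ℤ; _+_; _-_; _*_; 0ℤ; 1ℤ; -1ℤ; ∣_∣; _<_; _≤_; +0; +[1+_]; -[1+_]; +<+; _⊖_)
import Data.Integer.Properties as ℤP
open import Data.Integer.Tactic.RingSolver using (solve-∀; solve)
open import Data.Sign.Base using (Sign; opposite) renaming (_*_ to _*ˢ_; + to pos; - to neg)
import Data.Sign.Properties as Signₚ
open import Data.List using ([]; _∷_)
open import Data.Product using (Σ; ∃; _×_; _,_; proj₁; proj₂; map₂)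
open import Data.Sum using (inj₁; inj₂)
open import Function using (_∘_)
open import Relation.Nullary using (¬_; Dec; yes; no; contradiction)
open import Relation.Nullary.Decidable using (_×-dec_; ¬?; decidable-stable)
open import Relation.Binary.PropositionalEquality
  using (_≡_; _≢_; refl; sym; trans; cong; cong₂; subst; module ≡-Reasoning)
open import Relation.Binary.Construct.Closure.ReflexiveTransitive using (Star; ε; _◅_)

open ≡-Reasoning

sumFin-cong : ∀ n {f g : Fin n → ℤ} → (∀ i → f i ≡ g i) → sumFin n f ≡ sumFin n g
sumFin-cong zero    f≗g = refl
sumFin-cong (suc n) f≗g = cong₂ _+_ (f≗g zero) (sumFin-cong n (f≗g ∘ suc))

sumFin-scale : ∀ n c (f : Fin n → ℤ) → sumFin n (λ i → c * f i) ≡ c * sumFin n f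
sumFin-scale zero    c f = sym (ℤP.*-zeroʳ c)
sumFin-scale (suc n) c f = trans (cong ((c * f zero) +_) (sumFin-scale n c (f ∘ suc)))
                                 (sym (ℤP.*-distribˡ-+ c (f zero) _))

sumFin-sub : ∀ n (f g : Fin n → ℤ) → sumFin n (λ i → f i - g i) ≡ sumFin n f - sumFin n g
sumFin-sub zero    f g = refl
sumFin-sub (suc n) f g = trans (cong ((f zero - g zero) +_) (sumFin-sub n (f ∘ suc) (g ∘ suc)))
                               (interchange (f zero) (g zero) _ _)
  where
  interchange : ∀ a b c d → (a - b) + (c - d) ≡ (a + c) - (b + d)
  interchange = solve-∀

δ-suc : ∀ {n} (i k : Fin n) → δ (suc i) (suc k) ≡ δ i k
δ-suc i k with i ≟ᶠ k
... | yes _ = refl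
... | no  _ = refl

sumFin-δ : ∀ n (i : Fin n) (f : Fin n → ℤ) → sumFin n (λ k → δ i k * f k) ≡ f i
sumFin-δ (suc n) zero    f = trans (cong₂ _+_ (ℤP.*-identityˡ (f zero)) (sumFin-scale n 0ℤ (f ∘ suc)))
                                   (ℤP.+-identityʳ (f zero))
sumFin-δ (suc n) (suc i) f = begin
  0ℤ * f zero + sumFin n (λ k → δ (suc i) (suc k) * f (suc k))
    ≡⟨ ℤP.+-identityˡ _ ⟩
  sumFin n (λ k → δ (suc i) (suc k) * f (suc k))
    ≡⟨ sumFin-cong n (λ k → cong (_* f (suc k)) (δ-suc i k)) ⟩
  sumFin n (λ k → δ i k * f (suc k))
    ≡⟨ sumFin-δ n i (f ∘ suc) ⟩
  f (suc i) ∎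

sumFin-≤0 : ∀ n (f : Fin n → ℤ) → (∀ k → f k ≤ 0ℤ) → sumFin n f ≤ 0ℤ
sumFin-≤0 zero    f f≤0 = ℤP.≤-refl
sumFin-≤0 (suc n) f f≤0 = ℤP.+-mono-≤ (f≤0 zero) (sumFin-≤0 n (f ∘ suc) (f≤0 ∘ suc))

sumFin-<0 : ∀ n (f : Fin n → ℤ) j → (∀ k → f k ≤ 0ℤ) → f j < 0ℤ → sumFin n f < 0ℤ
sumFin-<0 (suc n) f zero    f≤0 fj<0 = ℤP.+-mono-<-≤ fj<0 (sumFin-≤0 n (f ∘ suc) (f≤0 ∘ suc))
sumFin-<0 (suc n) f (suc j) f≤0 fj<0 = ℤP.+-mono-≤-< (f≤0 zero) (sumFin-<0 n (f ∘ suc) j (f≤0 ∘ suc) fj<0)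

module _ {n : ℕ} (f : Fin n → ℤ) where

  private
    nonpositive : ¬ ∃ (λ k → 0ℤ < f k) → ∀ k → f k ≤ 0ℤ
    nonpositive none k = ℤP.≮⇒≥ (λ 0<fk → none (k , 0<fk))

  positive-term : 0ℤ < sumFin n f → ∃ λ k → 0ℤ < f k
  positive-term 0<Σf with any? (λ k → 0ℤ ℤP.<? f k)
  ... | yes found = found
  ... | no none   = contradiction 0<Σf (ℤP.≤⇒≯ (sumFin-≤0 n f (nonpositive none)))

  positive-term-of-zero-sum : ∀ j → sumFin n f ≡ 0ℤ → f j ≢ 0ℤ → ∃ λ k → 0ℤ < f k
  positive-term-of-zero-sum j Σf≡0 fj≢0 with any? (λ k → 0ℤ ℤP.<? f k)
  ... | yes found = found
  ... | no none   = contradiction Σf≡0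
        (ℤP.<⇒≢ (sumFin-<0 n f j (nonpositive none) (ℤP.≤∧≢⇒< (nonpositive none j) fj≢0)))

ℓ¹ : ∀ {n} → (Fin n → ℤ) → ℕ
ℓ¹ {zero}  f = 0
ℓ¹ {suc n} f = ∣ f zero ∣ ℕ.+ ℓ¹ (f ∘ suc)

ℓ¹-cong : ∀ {n} {f g : Fin n → ℤ} → (∀ k → ∣ f k ∣ ≡ ∣ g k ∣) → ℓ¹ f ≡ ℓ¹ g
ℓ¹-cong {zero}  eq = refl
ℓ¹-cong {suc n} eq = cong₂ ℕ._+_ (eq zero) (ℓ¹-cong (eq ∘ suc))

ℓ¹-decrement : ∀ {n} {f g : Fin n → ℤ} i → (∀ k → k ≢ i → ∣ g k ∣ ≡ ∣ f k ∣) →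
               suc ∣ g i ∣ ≡ ∣ f i ∣ → suc (ℓ¹ g) ≡ ℓ¹ f
ℓ¹-decrement zero    same at-i = cong₂ ℕ._+_ at-i (ℓ¹-cong (λ k → same (suc k) (λ ())))
ℓ¹-decrement (suc i) same at-i =
  trans (sym (ℕP.+-suc _ _))
        (cong₂ ℕ._+_ (same zero (λ ())) (ℓ¹-decrement i (λ k k≢i → same (suc k) (k≢i ∘ suc-injective)) at-i))

δ-refl : ∀ {n} (i : Fin n) → δ i i ≡ 1ℤ
δ-refl i with i ≟ᶠ i
... | yes _  = refl
... | no i≢i = contradiction refl i≢i

δ-≢ : ∀ {n} {i k : Fin n} → k ≢ i → δ i k ≡ 0ℤ
δ-≢ {i = i} {k} k≢i with i ≟ᶠ k
... | yes i≡k = contradiction (sym i≡k) k≢i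
... | no  _   = refl

⟦*⟧ : ∀ g h → ⟦ g *ˢ h ⟧ ≡ ⟦ g ⟧ * ⟦ h ⟧
⟦*⟧ pos pos = refl
⟦*⟧ pos neg = refl
⟦*⟧ neg pos = refl
⟦*⟧ neg neg = refl

⟦⟧-involutive : ∀ g z → ⟦ g ⟧ * (⟦ g ⟧ * z) ≡ z
⟦⟧-involutive pos z = solve (z ∷ [])
⟦⟧-involutive neg z = solve (z ∷ [])

⟦⟧-cancelˡ : ∀ g h z → ⟦ g ⟧ * (⟦ g *ˢ h ⟧ * z) ≡ ⟦ h ⟧ * z
⟦⟧-cancelˡ g h z = begin
  ⟦ g ⟧ * (⟦ g *ˢ h ⟧ * z)      ≡⟨ cong (λ c → ⟦ g ⟧ * (c * z)) (⟦*⟧ g h) ⟩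
  ⟦ g ⟧ * (⟦ g ⟧ * ⟦ h ⟧ * z)   ≡⟨ cong (⟦ g ⟧ *_) (ℤP.*-assoc ⟦ g ⟧ ⟦ h ⟧ z) ⟩
  ⟦ g ⟧ * (⟦ g ⟧ * (⟦ h ⟧ * z)) ≡⟨ ⟦⟧-involutive g (⟦ h ⟧ * z) ⟩
  ⟦ h ⟧ * z                     ∎

∣⟦g⟧*i∣≡∣i∣ : ∀ g z → ∣ ⟦ g ⟧ * z ∣ ≡ ∣ z ∣
∣⟦g⟧*i∣≡∣i∣ pos z = trans (ℤP.abs-* 1ℤ z) (ℕP.*-identityˡ ∣ z ∣)
∣⟦g⟧*i∣≡∣i∣ neg z = trans (ℤP.abs-* -1ℤ z) (ℕP.*-identityˡ ∣ z ∣)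

opposite-cancel : ∀ g h → g *ˢ opposite (g *ˢ h) ≡ opposite h
opposite-cancel pos h = refl
opposite-cancel neg pos = refl
opposite-cancel neg neg = refl

half-arrow-identity : ∀ ε ε′ X Y → ⟦ ε ⟧ * (⟦ ε ⟧ * X + ⟦ ε′ ⟧ * Y) ≡ X - ⟦ opposite (ε *ˢ ε′) ⟧ * Y
half-arrow-identity pos pos X Y = solve (X ∷ Y ∷ [])
half-arrow-identity pos neg X Y = solve (X ∷ Y ∷ [])
half-arrow-identity neg pos X Y = solve (X ∷ Y ∷ [])
half-arrow-identity neg neg X Y = solve (X ∷ Y ∷ [])

+-⟦neg⟧*-cancel : ∀ z → z + ⟦ neg ⟧ * z ≡ 0ℤ
+-⟦neg⟧*-cancel = solve-∀

shift-source : ∀ s τ A T H → ⟦ s ⟧ * ((A + ⟦ τ ⟧ * T) - (A - ⟦ s ⟧ * H)) ≡ H + ⟦ s *ˢ τ ⟧ * T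
shift-source pos pos A T H = solve (A ∷ T ∷ H ∷ [])
shift-source pos neg A T H = solve (A ∷ T ∷ H ∷ [])
shift-source neg pos A T H = solve (A ∷ T ∷ H ∷ [])
shift-source neg neg A T H = solve (A ∷ T ∷ H ∷ [])

reverse-sign : ∀ g₁ g₂ → ⟦ g₁ ⟧ + ⟦ opposite (g₁ *ˢ g₂) ⟧ * ⟦ g₂ ⟧ ≡ 0ℤ
reverse-sign pos pos = refl
reverse-sign pos neg = refl
reverse-sign neg pos = refl
reverse-sign neg neg = refl

opposite-signs-cancel : ∀ {g₁ g₂} → g₁ ≢ g₂ → ∀ X → ⟦ g₁ ⟧ * X + ⟦ g₂ ⟧ * X ≡ 0ℤ
opposite-signs-cancel {pos} {pos} g₁≢g₂ X = contradiction refl g₁≢g₂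
opposite-signs-cancel {pos} {neg} g₁≢g₂ X = solve (X ∷ [])
opposite-signs-cancel {neg} {pos} g₁≢g₂ X = solve (X ∷ [])
opposite-signs-cancel {neg} {neg} g₁≢g₂ X = contradiction refl g₁≢g₂

opposite-signs-σ : ∀ {g₁ g₂} → g₁ ≢ g₂ → opposite (g₁ *ˢ g₂) ≡ pos
opposite-signs-σ {pos} {pos} g₁≢g₂ = contradiction refl g₁≢g₂
opposite-signs-σ {pos} {neg} g₁≢g₂ = refl
opposite-signs-σ {neg} {pos} g₁≢g₂ = refl
opposite-signs-σ {neg} {neg} g₁≢g₂ = contradiction refl g₁≢g₂

positive-direction : ∀ g m X → 0ℤ < X * (⟦ g ⟧ * +[1+ m ]) → 0ℤ < ⟦ g ⟧ * X
positive-direction pos m +[1+ x ] _   = +<+ (s≤s z≤n)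
positive-direction neg m -[1+ x ] _   = +<+ (s≤s z≤n)
positive-direction pos m +0 (+<+ ())
positive-direction neg m +0 (+<+ ())
positive-direction pos m -[1+ x ] ()
positive-direction neg m +[1+ x ] ()

positive-product-nonzero : ∀ {x c} → 0ℤ < x * c → c ≢ 0ℤ
positive-product-nonzero {x} 0<x·c refl = ℤP.<-irrefl refl (subst (0ℤ <_) (ℤP.*-zeroʳ x) 0<x·c)

sign-multiple-nonzero : ∀ g m → ⟦ g ⟧ * +[1+ m ] ≢ 0ℤ
sign-multiple-nonzero pos m ()
sign-multiple-nonzero neg m ()

suc∣i-⟦g⟧∣≡∣i∣ : ∀ g z → 0ℤ < ⟦ g ⟧ * z → suc ∣ z - ⟦ g ⟧ ∣ ≡ ∣ z ∣
suc∣i-⟦g⟧∣≡∣i∣ pos +[1+ m ] _ = refl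
suc∣i-⟦g⟧∣≡∣i∣ neg -[1+ m ] _ =
  cong suc (trans (cong ∣_∣ (ℤP.[1+m]⊖[1+n]≡m⊖n 0 m)) (ℤP.∣m⊖n∣≡∣n⊖m∣ 0 m))
suc∣i-⟦g⟧∣≡∣i∣ pos +0 (+<+ ())
suc∣i-⟦g⟧∣≡∣i∣ neg +0 (+<+ ())
suc∣i-⟦g⟧∣≡∣i∣ pos -[1+ m ] ()
suc∣i-⟦g⟧∣≡∣i∣ neg +[1+ m ] ()

column : ∀ {n} (B : Bidirected n) → Fin n → V B → ℤ
column B i v = ⟦ sg₁ i ⟧ * δ (end₁ i) v + ⟦ sg₂ i ⟧ * δ (end₂ i) v
  where open Bidirected B

-- A single arrow as a graph of its own.  Facts about d(v, i) are proved here, where the ends are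
-- variables that can be matched on, and hold for every arrow i of B by unfolding the definitions.
arrowAt : ∀ {k} → Fin k → Sign → Fin k → Sign → Bidirected 1
arrowAt {k} e₁ g₁ e₂ g₂ =
  record { nV = k ; end₁ = λ _ → e₁ ; sg₁ = λ _ → g₁ ; end₂ = λ _ → e₂ ; sg₂ = λ _ → g₂ }

module _ {k : ℕ} where

  private
    drop-zero : ∀ a b → a * 1ℤ + b * 0ℤ ≡ a * 1ℤ
    drop-zero = solve-∀

    drop-zeroˡ : ∀ a b → a * 0ℤ + b * 1ℤ ≡ b * 1ℤ
    drop-zeroˡ = solve-∀

  first-end : ∀ (e₁ : Fin k) g₁ e₂ g₂ → let A = arrowAt e₁ g₁ e₂ g₂ in ¬ DirectedLoop A zero →
              dir A e₁ (arr zero) ≡ ⟦ g₁ ⟧ × ∃ λ m → column A zero e₁ ≡ ⟦ g₁ ⟧ * +[1+ m ]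
  first-end e₁ g₁ e₂ g₂ ¬loop with e₁ ≟ᶠ e₁ | e₂ ≟ᶠ e₁
  first-end e₁ g₁   e₂ g₂   ¬loop | no e₁≢e₁ | _       = contradiction refl e₁≢e₁
  first-end e₁ pos  e₂ g₂   ¬loop | yes _    | no _     = refl , 0 , drop-zero 1ℤ ⟦ g₂ ⟧
  first-end e₁ neg  e₂ g₂   ¬loop | yes _    | no _     = refl , 0 , drop-zero -1ℤ ⟦ g₂ ⟧
  first-end e₁ pos .e₁ pos  ¬loop | yes _    | yes refl = refl , 1 , refl
  first-end e₁ neg .e₁ neg  ¬loop | yes _    | yes refl = refl , 1 , refl
  first-end e₁ pos .e₁ neg  ¬loop | yes _    | yes refl = contradiction (refl , λ ()) ¬loop
  first-end e₁ neg .e₁ pos  ¬loop | yes _    | yes refl = contradiction (refl , λ ()) ¬loop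

  second-end : ∀ (e₁ : Fin k) g₁ e₂ g₂ → let A = arrowAt e₁ g₁ e₂ g₂ in ¬ DirectedLoop A zero →
               dir A e₂ (arr zero) ≡ ⟦ g₂ ⟧ × ∃ λ m → column A zero e₂ ≡ ⟦ g₂ ⟧ * +[1+ m ]
  second-end e₁ g₁ e₂ g₂ ¬loop with e₁ ≟ᶠ e₂ | e₂ ≟ᶠ e₂
  second-end e₁ g₁  e₂ g₂   ¬loop | _        | no e₂≢e₂ = contradiction refl e₂≢e₂
  second-end e₁ g₁  e₂ pos  ¬loop | no _     | yes _    = refl , 0 , drop-zeroˡ ⟦ g₁ ⟧ 1ℤ
  second-end e₁ g₁  e₂ neg  ¬loop | no _     | yes _    = refl , 0 , drop-zeroˡ ⟦ g₁ ⟧ -1ℤ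
  second-end e₁ pos .e₁ pos ¬loop | yes refl | yes _    = refl , 1 , refl
  second-end e₁ neg .e₁ neg ¬loop | yes refl | yes _    = refl , 1 , refl
  second-end e₁ pos .e₁ neg ¬loop | yes refl | yes _    = contradiction (refl , λ ()) ¬loop
  second-end e₁ neg .e₁ pos ¬loop | yes refl | yes _    = contradiction (refl , λ ()) ¬loop

  directed-loop-dirs : ∀ (e₁ : Fin k) g₁ e₂ g₂ → let A = arrowAt e₁ g₁ e₂ g₂ in (l : DirectedLoop A zero) →
                       dir A e₁ (arr zero) ≡ 1ℤ × dir A e₁ (inv zero l) ≡ -1ℤ
  directed-loop-dirs e₁ g₁ .e₁ g₂ (refl , g₁≢g₂) with e₁ ≟ᶠ e₁
  directed-loop-dirs e₁ g₁  .e₁ g₂  (refl , g₁≢g₂) | no e₁≢e₁ = contradiction refl e₁≢e₁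
  directed-loop-dirs e₁ pos .e₁ neg (refl , _)     | yes _    = refl , refl
  directed-loop-dirs e₁ neg .e₁ pos (refl , _)     | yes _    = refl , refl
  directed-loop-dirs e₁ pos .e₁ pos (refl , g₁≢g₂) | yes _    = contradiction refl g₁≢g₂
  directed-loop-dirs e₁ neg .e₁ neg (refl , g₁≢g₂) | yes _    = contradiction refl g₁≢g₂

module _ {n : ℕ} (B : Bidirected n) where
  open Bidirected B

  private
    variable
      a b c t u : V B
      i j : Fin n
      τ : Sign

  at-end₁ : ¬ DirectedLoop B i →
            dir B (end₁ i) (arr i) ≡ ⟦ sg₁ i ⟧ × ∃ λ m → column B i (end₁ i) ≡ ⟦ sg₁ i ⟧ * +[1+ m ]
  at-end₁ {i} = first-end (end₁ i) (sg₁ i) (end₂ i) (sg₂ i)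

  at-end₂ : ¬ DirectedLoop B i →
            dir B (end₂ i) (arr i) ≡ ⟦ sg₂ i ⟧ × ∃ λ m → column B i (end₂ i) ≡ ⟦ sg₂ i ⟧ * +[1+ m ]
  at-end₂ {i} = second-end (end₁ i) (sg₁ i) (end₂ i) (sg₂ i)

  loop-dirs : (l : DirectedLoop B i) → dir B (end₁ i) (arr i) ≡ 1ℤ × dir B (end₁ i) (inv i l) ≡ -1ℤ
  loop-dirs {i} = directed-loop-dirs (end₁ i) (sg₁ i) (end₂ i) (sg₂ i)

  directedLoop? : ∀ i → Dec (DirectedLoop B i)
  directedLoop? i = (end₁ i ≟ᶠ end₂ i) ×-dec ¬? (sg₁ i Signₚ.≟ sg₂ i)

  loop-ends : end₁ i ≡ end₂ i → EndsAre B i a b → a ≡ b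
  loop-ends loop (inj₁ (p , q)) = trans (sym p) (trans loop q)
  loop-ends loop (inj₂ (p , q)) = trans (sym q) (trans (sym loop) p)

  swapEnds : EndsAre B i a b → EndsAre B i b a
  swapEnds (inj₁ e) = inj₂ e
  swapEnds (inj₂ e) = inj₁ e

  directed-loop-column : DirectedLoop B i → ∀ v → column B i v ≡ 0ℤ
  directed-loop-column {i} (loop , g₁≢g₂) v =
    trans (cong (λ e → ⟦ sg₁ i ⟧ * δ (end₁ i) v + ⟦ sg₂ i ⟧ * δ e v) (sym loop))
          (opposite-signs-cancel g₁≢g₂ (δ (end₁ i) v))

  column-away : end₁ i ≢ a → end₂ i ≢ a → column B i a ≡ 0ℤ
  column-away {i} e₁≢a e₂≢a =
    trans (cong₂ (λ d d′ → ⟦ sg₁ i ⟧ * d + ⟦ sg₂ i ⟧ * d′) (δ-≢ (e₁≢a ∘ sym)) (δ-≢ (e₂≢a ∘ sym)))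
          (vanish ⟦ sg₁ i ⟧ ⟦ sg₂ i ⟧)
    where
    vanish : ∀ g₁ g₂ → g₁ * 0ℤ + g₂ * 0ℤ ≡ 0ℤ
    vanish = solve-∀

  column-at-end : ¬ DirectedLoop B i → EndsAre B i a b →
                  ∃ λ g → dir B a (arr i) ≡ ⟦ g ⟧ × ∃ λ m → column B i a ≡ ⟦ g ⟧ * +[1+ m ]
  column-at-end {i} ¬loop (inj₁ (refl , refl)) = sg₁ i , at-end₁ ¬loop
  column-at-end {i} ¬loop (inj₂ (refl , refl)) = sg₂ i , at-end₂ ¬loop

  directed-loop-step-column : DirectedLoop B i → EndsAre B i a b → ∀ z v →
                              z * column B i v ≡ δ a v - ⟦ σ B i ⟧ * δ b v
  directed-loop-step-column {i} {a} {b} l@(loop , g₁≢g₂) e z v = begin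
    z * column B i v               ≡⟨ cong (z *_) (directed-loop-column l v) ⟩
    z * 0ℤ                         ≡⟨ ℤP.*-zeroʳ z ⟩
    0ℤ                             ≡⟨ ℤP.+-inverseʳ (δ a v) ⟨
    δ a v - δ a v                  ≡⟨ cong (λ d → δ a v - d) (ℤP.*-identityˡ (δ a v)) ⟨
    δ a v - ⟦ pos ⟧ * δ a v        ≡⟨ cong₂ (λ g c → δ a v - ⟦ g ⟧ * δ c v)
                                            (sym (opposite-signs-σ g₁≢g₂)) (loop-ends loop e) ⟩
    δ a v - ⟦ σ B i ⟧ * δ b v      ∎

  arrow-column : ¬ DirectedLoop B i → EndsAre B i a b → ∀ v →
                 dir B a (arr i) * column B i v ≡ δ a v - ⟦ σ B i ⟧ * δ b v
  arrow-column {i} ¬loop (inj₁ (refl , refl)) v =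
    trans (cong (_* column B i v) (proj₁ (at-end₁ ¬loop)))
          (half-arrow-identity (sg₁ i) (sg₂ i) (δ (end₁ i) v) (δ (end₂ i) v))
  arrow-column {i} ¬loop (inj₂ (refl , refl)) v = begin
    dir B (end₂ i) (arr i) * column B i v
      ≡⟨ cong₂ _*_ (proj₁ (at-end₂ ¬loop)) (ℤP.+-comm (⟦ sg₁ i ⟧ * δ (end₁ i) v) _) ⟩
    ⟦ sg₂ i ⟧ * (⟦ sg₂ i ⟧ * δ (end₂ i) v + ⟦ sg₁ i ⟧ * δ (end₁ i) v)
      ≡⟨ half-arrow-identity (sg₂ i) (sg₁ i) (δ (end₂ i) v) (δ (end₁ i) v) ⟩
    δ (end₂ i) v - ⟦ opposite (sg₂ i *ˢ sg₁ i) ⟧ * δ (end₁ i) v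
      ≡⟨ cong (λ g → δ (end₂ i) v - ⟦ opposite g ⟧ * δ (end₁ i) v) (Signₚ.*-comm (sg₂ i) (sg₁ i)) ⟩
    δ (end₂ i) v - ⟦ σ B i ⟧ * δ (end₁ i) v ∎

  step-column : ∀ s → EndsAre B (stepArrow B s) a b → ∀ v →
                dir B a s * column B (stepArrow B s) v ≡ δ a v - ⟦ σ B (stepArrow B s) ⟧ * δ b v
  step-column {a} (inv i l) e v = directed-loop-step-column l e (dir B a (inv i l)) v
  step-column {a} (arr i) e v with directedLoop? i
  ... | yes l     = directed-loop-step-column l e (dir B a (arr i)) v
  ... | no  ¬loop = arrow-column ¬loop e v

  dir-reverse : a ≢ b → EndsAre B i a b → dir B a (arr i) + ⟦ σ B i ⟧ * dir B b (arr i) ≡ 0ℤ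
  dir-reverse {i = i} a≢b (inj₁ (refl , refl)) =
    trans (cong₂ (λ d d′ → d + ⟦ σ B i ⟧ * d′) (proj₁ (at-end₁ ¬loop)) (proj₁ (at-end₂ ¬loop)))
          (reverse-sign (sg₁ i) (sg₂ i))
    where ¬loop = λ (l : DirectedLoop B i) → a≢b (proj₁ l)
  dir-reverse {i = i} a≢b (inj₂ (refl , refl)) =
    trans (cong₂ (λ d d′ → d + ⟦ σ B i ⟧ * d′) (proj₁ (at-end₂ ¬loop)) (proj₁ (at-end₁ ¬loop)))
          (trans (cong (λ g → ⟦ sg₂ i ⟧ + ⟦ opposite g ⟧ * ⟦ sg₁ i ⟧) (Signₚ.*-comm (sg₁ i) (sg₂ i)))
                 (reverse-sign (sg₂ i) (sg₁ i)))
    where ¬loop = λ (l : DirectedLoop B i) → a≢b (sym (proj₁ l))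

  incT-scale : ∀ c (x : Fin n → ℤ) v → incT B (λ k → c * x k) v ≡ c * incT B x v
  incT-scale c x v =
    trans (sumFin-cong n (λ k → ℤP.*-assoc c (x k) (column B k v))) (sumFin-scale n c _)

  incT-sub : ∀ (x y : Fin n → ℤ) v → incT B (λ k → x k - y k) v ≡ incT B x v - incT B y v
  incT-sub x y v =
    trans (sumFin-cong n (λ k → distrib (x k) (y k) (column B k v))) (sumFin-sub n _ _)
    where
    distrib : ∀ p q r → (p - q) * r ≡ p * r - q * r
    distrib = solve-∀

  incT-δ : ∀ i v → incT B (δ i) v ≡ column B i v
  incT-δ i v = sumFin-δ n i (λ k → column B k v)

  Boundary : (Fin n → ℤ) → V B → V B → Sign → Set
  Boundary x a t τ = ∀ v → incT B x v ≡ δ a v + ⟦ τ ⟧ * δ t v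

  Balanced : (Fin n → ℤ) → Set
  Balanced x = ∀ v → incT B x v ≡ 0ℤ

  -- A step out of a on whose arrow x has the sign of d(a, step): following it lowers ‖x‖₁.
  record Exit (x : Fin n → ℤ) (a : V B) : Set where
    constructor exit
    field
      {head}   : V B
      out      : Step B
      ends     : EndsAre B (stepArrow B out) a head
      sign     : Sign
      dir≡sign : dir B a out ≡ ⟦ sign ⟧
      positive : 0ℤ < ⟦ sign ⟧ * x (stepArrow B out)

  ends-of-nonzero-column : column B i a ≢ 0ℤ → ∃ λ b → EndsAre B i a b
  ends-of-nonzero-column {i} {a} c≢0 = by-cases (end₁ i ≟ᶠ a) (end₂ i ≟ᶠ a)
    where
    by-cases : Dec (end₁ i ≡ a) → Dec (end₂ i ≡ a) → ∃ λ b → EndsAre B i a b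
    by-cases (yes e₁≡a) _          = end₂ i , inj₁ (e₁≡a , refl)
    by-cases (no  _)    (yes e₂≡a) = end₁ i , inj₂ (refl , e₂≡a)
    by-cases (no  e₁≢a) (no  e₂≢a) = contradiction (column-away e₁≢a e₂≢a) c≢0

  exit-of-column : ∀ {x : Fin n → ℤ} → 0ℤ < x i * column B i a → Exit x a
  exit-of-column {i} {a} {x} 0<x·c with directedLoop? i
  ... | yes l     = contradiction (directed-loop-column l a) c≢0
    where c≢0 = positive-product-nonzero {x i} {column B i a} 0<x·c
  ... | no  ¬loop with ends-of-nonzero-column (positive-product-nonzero {x i} {column B i a} 0<x·c)
  ...   | _ , e with column-at-end ¬loop e
  ...     | g , dir≡g , m , c≡g·m =
    exit (arr i) e g dir≡g (positive-direction g m (x i) (subst (λ c → 0ℤ < x i * c) c≡g·m 0<x·c))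

  exit-of-positive-incT : ∀ {x : Fin n → ℤ} → 0ℤ < incT B x a → Exit x a
  exit-of-positive-incT {a} {x} 0<Ix =
    exit-of-column (proj₂ (positive-term (λ k → x k * column B k a) 0<Ix))

  exit-of-directed-loop : ∀ {x : Fin n → ℤ} → DirectedLoop B j → x j ≢ 0ℤ → Exit x (end₁ j)
  exit-of-directed-loop {j} {x} l@(loop , _) xj≢0 = by-sign (0ℤ ℤP.<? x j)
    where
    at-loop : EndsAre B j (end₁ j) (end₁ j)
    at-loop = inj₁ (refl , sym loop)
    by-sign : Dec (0ℤ < x j) → Exit x (end₁ j)
    by-sign (yes 0<xj) = exit (arr j) at-loop pos (proj₁ (loop-dirs l))
                              (subst (0ℤ <_) (sym (ℤP.*-identityˡ (x j))) 0<xj)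
    by-sign (no  0≮xj) = exit (inv j l) at-loop neg (proj₂ (loop-dirs l))
                              (subst (0ℤ <_) (sym (ℤP.-1*i≡-i (x j)))
                                     (ℤP.neg-mono-< (ℤP.≤∧≢⇒< (ℤP.≮⇒≥ 0≮xj) xj≢0)))

  exit-of-balanced : ∀ {x : Fin n → ℤ} → Balanced x → x j ≢ 0ℤ → Exit x (end₁ j)
  exit-of-balanced {j} {x} balanced xj≢0 with directedLoop? j
  ... | yes l     = exit-of-directed-loop l xj≢0
  ... | no  ¬loop =
    exit-of-column (proj₂ (positive-term-of-zero-sum (λ k → x k * column B k (end₁ j)) j
                                                     (balanced (end₁ j)) xj·cj≢0))
    where
    cj≢0 : column B j (end₁ j) ≢ 0ℤ
    cj≢0 with at-end₁ ¬loop
    ... | _ , m , c≡g·m = sign-multiple-nonzero (sg₁ j) m ∘ trans (sym c≡g·m)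
    xj·cj≢0 : x j * column B j (end₁ j) ≢ 0ℤ
    xj·cj≢0 p with ℤP.i*j≡0⇒i≡0∨j≡0 (x j) p
    ... | inj₁ xj≡0 = xj≢0 xj≡0
    ... | inj₂ cj≡0 = cj≢0 cj≡0

  boundary⇒balanced : ∀ {x : Fin n → ℤ} → Boundary x u u neg → Balanced x
  boundary⇒balanced {u} ∂x v = trans (∂x v) (+-⟦neg⟧*-cancel (δ u v))

  balanced⇒boundary : ∀ {x : Fin n → ℤ} → Balanced x → Boundary x u u neg
  balanced⇒boundary {u} balanced v = trans (balanced v) (sym (+-⟦neg⟧*-cancel (δ u v)))

  wsign : Walk B a b → Sign
  wsign []           = pos
  wsign (step s _ ω) = σ B (stepArrow B s) *ˢ wsign ω

  _++ʷ_ : Walk B a b → Walk B b c → Walk B a c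
  []           ++ʷ ω₂ = ω₂
  (step s e ω) ++ʷ ω₂ = step s e (ω ++ʷ ω₂)

  wsign-++ : ∀ (ω₁ : Walk B a b) (ω₂ : Walk B b c) → wsign (ω₁ ++ʷ ω₂) ≡ wsign ω₁ *ˢ wsign ω₂
  wsign-++ []           ω₂ = refl
  wsign-++ (step s e ω) ω₂ =
    trans (cong (σ B (stepArrow B s) *ˢ_) (wsign-++ ω ω₂)) (sym (Signₚ.*-assoc (σ B (stepArrow B s)) _ _))

  incAcc-scale : ∀ g h (ω : Walk B a b) j → incAcc B (g *ˢ h) ω j ≡ ⟦ g ⟧ * incAcc B h ω j
  incAcc-scale g h []           j = sym (ℤP.*-zeroʳ ⟦ g ⟧)
  incAcc-scale {a} g h (step s e ω) j = begin
    ⟦ g *ˢ h ⟧ * dir B a s * δ i′ j + incAcc B (g *ˢ h *ˢ σ′) ω j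
      ≡⟨ cong₂ (λ p q → p * dir B a s * δ i′ j + q) (⟦*⟧ g h)
               (trans (cong (λ k → incAcc B k ω j) (Signₚ.*-assoc g h σ′)) (incAcc-scale g (h *ˢ σ′) ω j)) ⟩
    ⟦ g ⟧ * ⟦ h ⟧ * dir B a s * δ i′ j + ⟦ g ⟧ * incAcc B (h *ˢ σ′) ω j
      ≡⟨ factor ⟦ g ⟧ ⟦ h ⟧ (dir B a s) (δ i′ j) _ ⟩
    ⟦ g ⟧ * (⟦ h ⟧ * dir B a s * δ i′ j + incAcc B (h *ˢ σ′) ω j) ∎
    where
    i′ = stepArrow B s
    σ′ = σ B i′
    factor : ∀ p q d e r → p * q * d * e + p * r ≡ p * (q * d * e + r)
    factor = solve-∀

  incAcc-inc : ∀ g (ω : Walk B a b) j → incAcc B g ω j ≡ ⟦ g ⟧ * inc B ω j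
  incAcc-inc g ω j = trans (cong (λ h → incAcc B h ω j) (sym (Signₚ.*-identityʳ g))) (incAcc-scale g pos ω j)

  inc-step : ∀ s (e : EndsAre B (stepArrow B s) a b) (ω : Walk B b c) j →
             inc B (step s e ω) j ≡ dir B a s * δ (stepArrow B s) j + ⟦ σ B (stepArrow B s) ⟧ * inc B ω j
  inc-step {a} s e ω j =
    cong₂ _+_ (cong (_* δ (stepArrow B s) j) (ℤP.*-identityˡ (dir B a s)))
              (incAcc-inc (σ B (stepArrow B s)) ω j)

  inc-++ : ∀ (ω₁ : Walk B a b) (ω₂ : Walk B b c) j →
           inc B (ω₁ ++ʷ ω₂) j ≡ inc B ω₁ j + ⟦ wsign ω₁ ⟧ * inc B ω₂ j
  inc-++ []           ω₂ j = sym (trans (ℤP.+-identityˡ _) (ℤP.*-identityˡ _))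
  inc-++ {a} (step s e ω) ω₂ j = begin
    inc B (step s e (ω ++ʷ ω₂)) j
      ≡⟨ inc-step s e (ω ++ʷ ω₂) j ⟩
    d + ⟦ σ′ ⟧ * inc B (ω ++ʷ ω₂) j
      ≡⟨ cong (λ r → d + ⟦ σ′ ⟧ * r) (inc-++ ω ω₂ j) ⟩
    d + ⟦ σ′ ⟧ * (inc B ω j + ⟦ wsign ω ⟧ * inc B ω₂ j)
      ≡⟨ regroup d ⟦ σ′ ⟧ (inc B ω j) ⟦ wsign ω ⟧ (inc B ω₂ j) ⟩
    (d + ⟦ σ′ ⟧ * inc B ω j) + ⟦ σ′ ⟧ * ⟦ wsign ω ⟧ * inc B ω₂ j
      ≡⟨ cong₂ (λ p q → p + q * inc B ω₂ j) (sym (inc-step s e ω j)) (sym (⟦*⟧ σ′ (wsign ω))) ⟩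
    inc B (step s e ω) j + ⟦ σ′ *ˢ wsign ω ⟧ * inc B ω₂ j ∎
    where
    σ′ = σ B (stepArrow B s)
    d  = dir B a s * δ (stepArrow B s) j
    regroup : ∀ d s r w r′ → d + s * (r + w * r′) ≡ (d + s * r) + s * w * r′
    regroup = solve-∀

  -- wsign is σ(ω), and τ = −σ(ω) matches I(B)ᵀ inc(ω) = e_a − σ(ω) e_t.
  Realises : V B → V B → Sign → (Fin n → ℤ) → Set
  Realises a t τ x = Σ (Walk B a t) λ ω → (∀ j → x j ≡ inc B ω j) × wsign ω ≡ opposite τ

  realises-cong : ∀ {x y : Fin n → ℤ} → (∀ k → x k ≡ y k) → Realises a t τ y → Realises a t τ x
  realises-cong x≗y (ω , realises , sign) = ω , (λ k → trans (x≗y k) (realises k)) , sign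

  module Peel {x : Fin n → ℤ} {a t τ} (∂x : Boundary x a t τ) (E : Exit x a) where
    open Exit E

    private
      i′ = stepArrow B out
      s  = σ B i′

    remainder : Fin n → ℤ
    remainder k = ⟦ s ⟧ * (x k - ⟦ sign ⟧ * δ i′ k)

    remainder-boundary : Boundary remainder head t (s *ˢ τ)
    remainder-boundary v = begin
      incT B remainder v
        ≡⟨ incT-scale ⟦ s ⟧ (λ k → x k - ⟦ sign ⟧ * δ i′ k) v ⟩
      ⟦ s ⟧ * incT B (λ k → x k - ⟦ sign ⟧ * δ i′ k) v
        ≡⟨ cong (⟦ s ⟧ *_) (incT-sub x (λ k → ⟦ sign ⟧ * δ i′ k) v) ⟩
      ⟦ s ⟧ * (incT B x v - incT B (λ k → ⟦ sign ⟧ * δ i′ k) v)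
        ≡⟨ cong (λ z → ⟦ s ⟧ * (incT B x v - z))
                (trans (incT-scale ⟦ sign ⟧ (δ i′) v) (cong (⟦ sign ⟧ *_) (incT-δ i′ v))) ⟩
      ⟦ s ⟧ * (incT B x v - ⟦ sign ⟧ * column B i′ v)
        ≡⟨ cong₂ (λ p q → ⟦ s ⟧ * (p - q)) (∂x v)
                 (trans (cong (_* column B i′ v) (sym dir≡sign)) (step-column out ends v)) ⟩
      ⟦ s ⟧ * ((δ a v + ⟦ τ ⟧ * δ t v) - (δ a v - ⟦ s ⟧ * δ head v))
        ≡⟨ shift-source s τ (δ a v) (δ t v) (δ head v) ⟩
      δ head v + ⟦ s *ˢ τ ⟧ * δ t v ∎

    remainder-ℓ¹ : suc (ℓ¹ remainder) ≡ ℓ¹ x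
    remainder-ℓ¹ = ℓ¹-decrement i′ off-i′ at-i′
      where
      off-i′ : ∀ k → k ≢ i′ → ∣ remainder k ∣ ≡ ∣ x k ∣
      off-i′ k k≢i′ = begin
        ∣ ⟦ s ⟧ * (x k - ⟦ sign ⟧ * δ i′ k) ∣  ≡⟨ ∣⟦g⟧*i∣≡∣i∣ s _ ⟩
        ∣ x k - ⟦ sign ⟧ * δ i′ k ∣            ≡⟨ cong (λ d → ∣ x k - ⟦ sign ⟧ * d ∣) (δ-≢ k≢i′) ⟩
        ∣ x k - ⟦ sign ⟧ * 0ℤ ∣                ≡⟨ cong ∣_∣ (drop (x k) ⟦ sign ⟧) ⟩
        ∣ x k ∣                                ∎
        where
        drop : ∀ p q → p - q * 0ℤ ≡ p
        drop = solve-∀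
      at-i′ : suc ∣ remainder i′ ∣ ≡ ∣ x i′ ∣
      at-i′ = begin
        suc ∣ ⟦ s ⟧ * (x i′ - ⟦ sign ⟧ * δ i′ i′) ∣  ≡⟨ cong suc (∣⟦g⟧*i∣≡∣i∣ s _) ⟩
        suc ∣ x i′ - ⟦ sign ⟧ * δ i′ i′ ∣            ≡⟨ cong (λ d → suc ∣ x i′ - ⟦ sign ⟧ * d ∣) (δ-refl i′) ⟩
        suc ∣ x i′ - ⟦ sign ⟧ * 1ℤ ∣                 ≡⟨ cong (λ d → suc ∣ x i′ - d ∣) (ℤP.*-identityʳ ⟦ sign ⟧) ⟩
        suc ∣ x i′ - ⟦ sign ⟧ ∣                      ≡⟨ suc∣i-⟦g⟧∣≡∣i∣ sign (x i′) positive ⟩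
        ∣ x i′ ∣                                     ∎

    realises-prepend : Realises head t (s *ˢ τ) remainder → Realises a t τ x
    realises-prepend (ω , ω-realises , ω-sign) =
      step out ends ω , realises , trans (cong (s *ˢ_) ω-sign) (opposite-cancel s τ)
      where
      realises : ∀ j → x j ≡ inc B (step out ends ω) j
      realises j = sym (begin
        inc B (step out ends ω) j
          ≡⟨ inc-step out ends ω j ⟩
        dir B a out * δ i′ j + ⟦ s ⟧ * inc B ω j
          ≡⟨ cong₂ (λ d r → d * δ i′ j + ⟦ s ⟧ * r) dir≡sign (sym (ω-realises j)) ⟩
        ⟦ sign ⟧ * δ i′ j + ⟦ s ⟧ * (⟦ s ⟧ * (x j - ⟦ sign ⟧ * δ i′ j))
          ≡⟨ cong (⟦ sign ⟧ * δ i′ j +_) (⟦⟧-involutive s _) ⟩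
        ⟦ sign ⟧ * δ i′ j + (x j - ⟦ sign ⟧ * δ i′ j)
          ≡⟨ restore (⟦ sign ⟧ * δ i′ j) (x j) ⟩
        x j ∎)
        where
        restore : ∀ p q → p + (q - p) ≡ q
        restore = solve-∀

  detour : EndsAre B i a b → Walk B b b → Walk B a a
  detour {i} e ω = step (arr i) e (ω ++ʷ step (arr i) (swapEnds e) [])

  wsign-detour : ∀ (e : EndsAre B i a b) ω → wsign ω ≡ pos → wsign (detour e ω) ≡ pos
  wsign-detour {i} e ω ω-sign = begin
    σ B i *ˢ wsign (ω ++ʷ step (arr i) (swapEnds e) [])  ≡⟨ cong (σ B i *ˢ_) (wsign-++ ω _) ⟩
    σ B i *ˢ (wsign ω *ˢ (σ B i *ˢ pos))                 ≡⟨ cong (λ w → σ B i *ˢ (w *ˢ (σ B i *ˢ pos))) ω-sign ⟩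
    σ B i *ˢ (σ B i *ˢ pos)                              ≡⟨ cong (σ B i *ˢ_) (Signₚ.*-identityʳ (σ B i)) ⟩
    σ B i *ˢ σ B i                                       ≡⟨ Signₚ.s*s≡+ (σ B i) ⟩
    pos                                                  ∎

  inc-detour : a ≢ b → ∀ (e : EndsAre B i a b) ω → wsign ω ≡ pos → ∀ j →
               inc B (detour e ω) j ≡ ⟦ σ B i ⟧ * inc B ω j
  inc-detour {a} {b} {i} a≢b e ω ω-sign j = begin
    inc B (detour e ω) j
      ≡⟨ inc-step (arr i) e (ω ++ʷ back) j ⟩
    dₐ * δ i j + ⟦ s ⟧ * inc B (ω ++ʷ back) j
      ≡⟨ cong (λ r → dₐ * δ i j + ⟦ s ⟧ * r) (inc-++ ω back j) ⟩
    dₐ * δ i j + ⟦ s ⟧ * (inc B ω j + ⟦ wsign ω ⟧ * inc B back j)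
      ≡⟨ cong (λ w → dₐ * δ i j + ⟦ s ⟧ * (inc B ω j + ⟦ w ⟧ * inc B back j)) ω-sign ⟩
    dₐ * δ i j + ⟦ s ⟧ * (inc B ω j + 1ℤ * (1ℤ * d_b * δ i j + 0ℤ))   -- inc B back j, unfolded
      ≡⟨ regroup dₐ d_b (δ i j) ⟦ s ⟧ (inc B ω j) ⟩
    (dₐ + ⟦ s ⟧ * d_b) * δ i j + ⟦ s ⟧ * inc B ω j
      ≡⟨ cong (λ z → z * δ i j + ⟦ s ⟧ * inc B ω j) (dir-reverse a≢b e) ⟩
    0ℤ * δ i j + ⟦ s ⟧ * inc B ω j
      ≡⟨ ℤP.+-identityˡ _ ⟩
    ⟦ s ⟧ * inc B ω j ∎
    where
    back = step (arr i) (swapEnds e) []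
    s    = σ B i
    dₐ   = dir B a (arr i)
    d_b  = dir B b (arr i)
    regroup : ∀ dₐ d_b d s r → dₐ * d + s * (r + 1ℤ * (1ℤ * d_b * d + 0ℤ)) ≡ (dₐ + s * d_b) * d + s * r
    regroup = solve-∀

  ClosedWalks : V B → (Fin n → ℤ) → Set
  ClosedWalks u y = ∀ g → Realises u u neg (λ k → ⟦ g ⟧ * y k)

  transport : ∀ {y : Fin n → ℤ} → Star (Adjacent B) a u → ClosedWalks u y → ClosedWalks a y
  transport ε closed = closed
  transport {a} {y = y} (_◅_ {j = b} (i , e) path) closed with a ≟ᶠ b
  ... | yes refl = transport path closed
  ... | no  a≢b  = λ g → via g (transport path closed (σ B i *ˢ g))
    where
    via : ∀ g → Realises b b neg (λ k → ⟦ σ B i *ˢ g ⟧ * y k) → Realises a a neg (λ k → ⟦ g ⟧ * y k)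
    via g (ω , ω-realises , ω-sign) = detour e ω , realises , wsign-detour e ω ω-sign
      where
      realises : ∀ k → ⟦ g ⟧ * y k ≡ inc B (detour e ω) k
      realises k = sym (begin
        inc B (detour e ω) k                ≡⟨ inc-detour a≢b e ω ω-sign k ⟩
        ⟦ σ B i ⟧ * inc B ω k               ≡⟨ cong (⟦ σ B i ⟧ *_) (sym (ω-realises k)) ⟩
        ⟦ σ B i ⟧ * (⟦ σ B i *ˢ g ⟧ * y k)  ≡⟨ ⟦⟧-cancelˡ (σ B i) g (y k) ⟩
        ⟦ g ⟧ * y k                         ∎)

  positive-at-source : ∀ {x : Fin n → ℤ} {s} → Boundary x s t τ → ¬ (s ≡ t × τ ≡ neg) → 0ℤ < incT B x s
  positive-at-source {t} {τ} {x} {s} ∂x not-closed with s ≟ᶠ t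
  ... | no s≢t = subst (0ℤ <_) (sym (begin
    incT B x s                 ≡⟨ ∂x s ⟩
    δ s s + ⟦ τ ⟧ * δ t s      ≡⟨ cong₂ (λ p q → p + ⟦ τ ⟧ * q) (δ-refl s) (δ-≢ s≢t) ⟩
    1ℤ + ⟦ τ ⟧ * 0ℤ            ≡⟨ cong (1ℤ +_) (ℤP.*-zeroʳ ⟦ τ ⟧) ⟩
    1ℤ                         ∎)) (+<+ (s≤s z≤n))
  ... | yes refl = subst (0ℤ <_) (sym (trans (∂x s) (cong (λ d → d + ⟦ τ ⟧ * d) (δ-refl s))))
                         (two τ (λ τ≡neg → not-closed (refl , τ≡neg)))
    where
    two : ∀ τ′ → τ′ ≢ neg → 0ℤ < 1ℤ + ⟦ τ′ ⟧ * 1ℤ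
    two pos _      = +<+ (s≤s z≤n)
    two neg τ′≢neg = contradiction refl τ′≢neg

  module _ (connected : Connected B) where

    mutual
      realise-via : ∀ N (x : Fin n → ℤ) → ℓ¹ x ≡ N → Boundary x a t τ → Exit x a → Realises a t τ x
      realise-via {a} {t} {τ} zero x ℓ¹x≡0 ∂x E =
        contradiction (trans (Peel.remainder-ℓ¹ {a = a} {t} {τ} ∂x E) ℓ¹x≡0) λ ()
      realise-via {a} {t} {τ} (suc N) x ℓ¹x≡1+N ∂x E =
        realises-prepend
          (realise N remainder (ℕP.suc-injective (trans remainder-ℓ¹ ℓ¹x≡1+N)) remainder-boundary)
        where open Peel {a = a} {t} {τ} ∂x E

      realise : ∀ N (x : Fin n → ℤ) → ℓ¹ x ≡ N → Boundary x a t τ → Realises a t τ x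
      realise {a} {t} {τ} N x ℓ¹x≡N ∂x with (a ≟ᶠ t) ×-dec (τ Signₚ.≟ neg)
      ... | yes (refl , refl) = realise-closed N x ℓ¹x≡N (boundary⇒balanced {u = a} {x} ∂x)
      ... | no  not-closed    =
        realise-via N x ℓ¹x≡N ∂x (exit-of-positive-incT (positive-at-source {x = x} ∂x not-closed))

      realise-closed : ∀ N (x : Fin n → ℤ) → ℓ¹ x ≡ N → Balanced x → Realises a a neg x
      realise-closed {a} N x ℓ¹x≡N balanced with any? (λ k → ¬? (x k ℤP.≟ 0ℤ))
      ... | no  x≡0         = [] , (λ k → decidable-stable (x k ℤP.≟ 0ℤ) (λ xk≢0 → x≡0 (k , xk≢0))) , refl
      ... | yes (j , xj≢0) =
        realises-cong (λ k → sym (ℤP.*-identityˡ (x k))) (transport (connected a (end₁ j)) closed-at-j pos)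
        where
        closed-at-j : ClosedWalks (end₁ j) x
        closed-at-j g = realise-via N g·x (trans (ℓ¹-cong (λ k → ∣⟦g⟧*i∣≡∣i∣ g (x k))) ℓ¹x≡N)
                                    (balanced⇒boundary {u = end₁ j} {g·x} g·x-balanced)
                                    (exit-of-balanced g·x-balanced g·xj≢0)
          where
          g·x : Fin n → ℤ
          g·x k = ⟦ g ⟧ * x k
          g·x-balanced : Balanced g·x
          g·x-balanced v =
            trans (incT-scale ⟦ g ⟧ x v) (trans (cong (⟦ g ⟧ *_) (balanced v)) (ℤP.*-zeroʳ ⟦ g ⟧))
          g·xj≢0 : g·x j ≢ 0ℤ
          g·xj≢0 g·xj≡0 = xj≢0 (ℤP.∣i∣≡0⇒i≡0 (trans (sym (∣⟦g⟧*i∣≡∣i∣ g (x j))) (cong ∣_∣ g·xj≡0)))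


proposition6p3 : (m : ℕ) (B : Bidirected (suc m)) → Connected B →
    (x : Fin (suc m) → ℤ) (s t : V B) (τ : Sign) →
    (∀ v → incT B x v ≡ δ s v + ⟦ τ ⟧ * δ t v) →
    Σ (Walk B s t) (λ ω → ∀ j → x j ≡ inc B ω j)
proposition6p3 m B connected x s t τ ∂x = map₂ proj₁ (realise B connected {s} {t} {τ} (ℓ¹ x) x refl ∂x)
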